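{- Let $C_n$ be the cycle on $n\geq 5$ vertices. If $n$ is odd, then $\mathrm{Hull}(C_n)$ is the complete graph $K_n$. If $n$ is even, then $\mathrm{Hull}(C_n)$ is the complete bipartite graph whose parts are the two colour classes of $C_n$.
   Context: For a set $M$ of transformations of the vertex set $V$ (acting on the right), $\mathrm{Gr}(M)$ is the graph on $V$ in which distinct $v,w$ are adjacent iff no $f\in M$ satisfies $vf=wf$. The hull of a graph $X$ is $\mathrm{Hull}(X)=\mathrm{Gr}(\mathrm{End}(X))$, where $\mathrm{End}(X)$ is the endomorphism monoid of $X$. -}

module Defs where

open import Data.Nat using (ℕ; zero; suc; _+_; _∸_; _%_)
open import Data.Sum using (_⊎_)
open import Data.Fin using (Fin; toℕ)
open import Data.Product using (Σ; ∃; _×_; _,_)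
open import Relation.Nullary using (¬_)
open import Relation.Binary.PropositionalEquality using (_≡_; _≢_)

record Graph (n : ℕ) : Set₁ where
  field
    Adj : Fin n → Fin n → Set

open Graph public

IsEndomorphism : ∀ {n} → Graph n → (Fin n → Fin n) → Set
IsEndomorphism X f = ∀ x y → Adj X x y → Adj X (f x) (f y)

End : ∀ {n} → Graph n → (Fin n → Fin n) → Set
End X f = IsEndomorphism X f

Gr : ∀ {n} → ((Fin n → Fin n) → Set) → Graph n
Gr M = record { Adj = λ v w → v ≢ w × ¬ (Σ (Fin _ → Fin _) λ f → M f × f v ≡ f w) }

Hull : ∀ {n} → Graph n → Graph n
Hull X = Gr (End X)

-- The cycle C_n on vertices 0,…,n-1: consecutive indices are adjacent,
-- and 0 is adjacent to n-1 (i.e. i ~ j iff j ≡ i ± 1 mod n).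
CycleStep : (n : ℕ) → Fin n → Fin n → Set
CycleStep n i j = (toℕ j ≡ suc (toℕ i)) ⊎ ((toℕ i ≡ n ∸ 1) × (toℕ j ≡ 0))

Cycle : (n : ℕ) → Graph n
Cycle n = record { Adj = λ i j → CycleStep n i j ⊎ CycleStep n j i }

Complete : (n : ℕ) → Graph n
Complete n = record { Adj = λ v w → v ≢ w }

-- Complete bipartite graph whose parts are the vertices of even resp. odd index
-- (these are the two colour classes of C_n when n is even).
CompleteBipartiteParity : (n : ℕ) → Graph n
CompleteBipartiteParity n = record { Adj = λ v w → toℕ v % 2 ≢ toℕ w % 2 }

_≅ᴳ_ : ∀ {n} → Graph n → Graph n → Set
X ≅ᴳ Y = ∀ v w → (Adj X v w → Adj Y v w) × (Adj Y v w → Adj X v w)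

module Submission where

-- Write N for the number of vertices, vertex i for i mod N, and view an
-- endomorphism f of C_N through the sequence h i = f(vertex i).  Each edge
-- vertex i ~ vertex (i+1) is mapped to an edge, so h is a walk on the cycle
-- taking N steps of +1 or −1 (mod N) and returning to its start.
--
-- * Odd N.  If the walk takes fwd steps forwards and back steps backwards,
--   then fwd + back = N and, the walk being closed, fwd ≡ back (mod N).
--   As N is odd this forces one of them to vanish: the walk winds once
--   around the cycle in one direction, so h i ≡ h 0 ± i and f is injective.
--   Hence no endomorphism identifies two vertices and Hull(C_N) = K_N.
-- * Even N.  Adjacent vertices have opposite parity, so the parity of f(u)
--   plus the parity of u is constant along the cycle; an endomorphism can
--   therefore only identify vertices of equal parity.  Conversely the map
--   sending even vertices to 0 and odd ones to 1 is an endomorphism that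
--   identifies any two vertices of equal parity.  So Hull(C_N) = K_{A,B}
--   for the two parity classes A, B.
--
-- Both arguments work for every N ≥ 2; the theorem asks for N ≥ 5.

open import Defs
open import Data.Nat using (ℕ; _≤_; _%_)
open import Data.Product using (_×_)
open import Relation.Binary.PropositionalEquality using (_≡_)

open import Data.Nat using (zero; suc; _+_; _*_; _<_; _≤′_; ≤′-refl; ≤′-step; s≤s; parity)
open import Data.Nat.Properties
open import Data.Nat.DivMod
open import Data.Parity.Base using (Parity; 0ℙ; 1ℙ; _⁻¹) renaming (_+_ to _⊕_)
import Data.Parity.Properties as ℙ
open import Data.Fin using (Fin; toℕ; fromℕ<) renaming (zero to fzero; suc to fsuc)
open import Data.Fin.Properties using (toℕ-injective; toℕ<n; toℕ-fromℕ<)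
open import Data.Bool using (Bool; true; false; not; if_then_else_)
open import Data.Sum using (inj₁; inj₂; _⊎_)
open import Data.Product using (Σ; _,_; proj₁; proj₂)
open import Function using (_∘_)
open import Relation.Nullary using (contradiction)
open import Relation.Binary.PropositionalEquality
  using (refl; sym; trans; cong; cong₂; subst; module ≡-Reasoning)

-- Parity versus remainder modulo 2: the statement speaks of n % 2,
-- the proof works in the group Parity.

parityBit : Parity → ℕ
parityBit 0ℙ = 0
parityBit 1ℙ = 1

parityBit-injective : ∀ {p q} → parityBit p ≡ parityBit q → p ≡ q
parityBit-injective {0ℙ} {0ℙ} _ = refl
parityBit-injective {1ℙ} {1ℙ} _ = refl

%2≡parityBit : ∀ n → n % 2 ≡ parityBit (parity n)
%2≡parityBit zero = refl
%2≡parityBit (suc zero) = refl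
%2≡parityBit (suc (suc n)) =
  trans (cong (_% 2) (+-comm 2 n)) (trans ([m+n]%n≡m%n n 2) (%2≡parityBit n))

%2⇒parity : ∀ n {p} → n % 2 ≡ parityBit p → parity n ≡ p
%2⇒parity n e = parityBit-injective (trans (sym (%2≡parityBit n)) e)

same-%2⇒same-parity : ∀ a b → a % 2 ≡ b % 2 → parity a ≡ parity b
same-%2⇒same-parity a b e = %2⇒parity a (trans e (%2≡parityBit b))

same-parity⇒same-%2 : ∀ a b → parity a ≡ parity b → a % 2 ≡ b % 2
same-parity⇒same-%2 a b e =
  trans (%2≡parityBit a) (trans (cong parityBit e) (sym (%2≡parityBit b)))

parity-suc : ∀ n → parity (suc n) ≡ parity n ⁻¹
parity-suc n = sym (ℙ.⁻¹-selfInverse (ℙ.suc-homo-⁻¹ n))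

⁻¹⊕⁻¹ : ∀ p q → p ⁻¹ ⊕ q ⁻¹ ≡ p ⊕ q
⁻¹⊕⁻¹ 0ℙ 0ℙ = refl
⁻¹⊕⁻¹ 0ℙ 1ℙ = refl
⁻¹⊕⁻¹ 1ℙ 0ℙ = refl
⁻¹⊕⁻¹ 1ℙ 1ℙ = refl

count : (ℕ → Bool) → ℕ → ℕ
count p zero = 0
count p (suc i) = if p i then suc (count p i) else count p i

count-split : ∀ p i → count p i + count (not ∘ p) i ≡ i
count-split p zero = refl
count-split p (suc i) with p i
... | true = cong suc (count-split p i)
... | false = trans (+-suc (count p i) _) (cong suc (count-split p i))

count-mono : ∀ p {i j} → i ≤′ j → count p i ≤ count p j
count-mono p ≤′-refl = ≤-refl
count-mono p {j = suc j} (≤′-step i≤j) with p j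
... | true = m≤n⇒m≤1+n (count-mono p i≤j)
... | false = count-mono p i≤j

count-vanishes : ∀ p {i n} → count p n ≡ 0 → i ≤ n → count p i ≡ 0
count-vanishes p c≡0 i≤n = n≤0⇒n≡0 (≤-trans (count-mono p (≤⇒≤′ i≤n)) (≤-reflexive c≡0))

module Modular (m : ℕ) where

  N : ℕ
  N = suc m

  infix 4 _≋_
  _≋_ : ℕ → ℕ → Set
  x ≋ y = x % N ≡ y % N

  ≋-+ˡ : ∀ k x y → x ≋ y → k + x ≋ k + y
  ≋-+ˡ k x y e = trans (%-distribˡ-+ k x N)
    (trans (cong (λ z → (k % N + z) % N) e) (sym (%-distribˡ-+ k y N)))

  ≋-+ʳ : ∀ x y k → x ≋ y → x + k ≋ y + k
  ≋-+ʳ x y k e = trans (%-distribˡ-+ x k N)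
    (trans (cong (λ z → (z + k % N) % N) e) (sym (%-distribˡ-+ y k N)))

  -- Addition of x is invertible modulo N: add x * m to undo it.
  ≋-cancelˡ : ∀ x {a b} → x + a ≋ x + b → a ≋ b
  ≋-cancelˡ x {a} {b} e = begin
      a % N                  ≡⟨ sym ([m+kn]%n≡m%n a x N) ⟩
      (a + x * N) % N        ≡⟨ cong (_% N) (undo a) ⟩
      ((x + a) + x * m) % N  ≡⟨ ≋-+ʳ (x + a) (x + b) (x * m) e ⟩
      ((x + b) + x * m) % N  ≡⟨ cong (_% N) (sym (undo b)) ⟩
      (b + x * N) % N        ≡⟨ [m+kn]%n≡m%n b x N ⟩
      b % N                  ∎
    where
      open ≡-Reasoning
      undo : ∀ c → c + x * N ≡ (x + c) + x * m
      undo c = trans (cong (c +_) (*-suc x m))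
        (trans (sym (+-assoc c x (x * m))) (cong (_+ x * m) (+-comm c x)))

  ≋⇒≡ : ∀ {i j} → i < N → j < N → i ≋ j → i ≡ j
  ≋⇒≡ i<N j<N e = trans (sym (m<n⇒m%n≡m i<N)) (trans e (m<n⇒m%n≡m j<N))

  -- If a + b = N is odd and a ≡ b (mod N), then a or b is zero:
  -- otherwise both are residues, so a = b and N = 2a would be even.
  odd-split : ∀ {a b} → a + b ≡ N → parity N ≡ 1ℙ → a ≋ b → a ≡ 0 ⊎ b ≡ 0
  odd-split {a} {b} a+b≡N N-odd a≋b
    with m≤n⇒m<n∨m≡n (≤-trans (m≤m+n a b) (≤-reflexive a+b≡N))
       | m≤n⇒m<n∨m≡n (≤-trans (m≤n+m b a) (≤-reflexive a+b≡N))
  ... | inj₂ a≡N | _ = inj₂ (+-cancelˡ-≡ a b 0 (trans a+b≡N (trans (sym a≡N) (sym (+-identityʳ a)))))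
  ... | _ | inj₂ b≡N = inj₁ (+-cancelʳ-≡ b a 0 (trans a+b≡N (sym b≡N)))
  ... | inj₁ a<N | inj₁ b<N = contradiction (trans (sym N-odd) N-even) λ ()
    where
      open ≡-Reasoning
      N-even : parity N ≡ 0ℙ
      N-even = begin
        parity N                  ≡⟨ cong parity (sym a+b≡N) ⟩
        parity (a + b)            ≡⟨ cong (λ z → parity (a + z)) (sym (≋⇒≡ a<N b<N a≋b)) ⟩
        parity (a + a)            ≡⟨ ℙ.+-homo-+ a a ⟩
        parity a ⊕ parity a       ≡⟨ ℙ.p+p≡0ℙ (parity a) ⟩
        0ℙ                        ∎

  Step : Bool → ℕ → ℕ → Set
  Step true x y = suc x % N ≡ y
  Step false x y = suc y % N ≡ x

  module Walk (h : ℕ → ℕ) (h<N : ∀ i → h i < N) (forward : ℕ → Bool)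
              (step : ∀ i → Step (forward i) (h i) (h (suc i))) where

    fwd back : ℕ → ℕ
    fwd = count forward
    back = count (not ∘ forward)

    winding : ∀ i → h i + back i ≋ h 0 + fwd i
    winding zero = refl
    winding (suc i) with forward i | step i
    ... | true | s = begin
        (h (suc i) + back i) % N    ≡⟨ ≋-+ʳ (h (suc i)) (suc (h i)) (back i) (trans (cong (_% N) (sym s)) (m%n%n≡m%n (suc (h i)) N)) ⟩
        (suc (h i) + back i) % N    ≡⟨ ≋-+ˡ 1 (h i + back i) (h 0 + fwd i) (winding i) ⟩
        (suc (h 0 + fwd i)) % N     ≡⟨ cong (_% N) (sym (+-suc (h 0) (fwd i))) ⟩
        (h 0 + suc (fwd i)) % N     ∎
      where open ≡-Reasoning
    ... | false | s = begin
        (h (suc i) + suc (back i)) % N  ≡⟨ cong (_% N) (+-suc (h (suc i)) (back i)) ⟩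
        (suc (h (suc i)) + back i) % N  ≡⟨ ≋-+ʳ (suc (h (suc i))) (h i) (back i) (trans s (sym (m<n⇒m%n≡m (h<N i)))) ⟩
        (h i + back i) % N              ≡⟨ winding i ⟩
        (h 0 + fwd i) % N               ∎
      where open ≡-Reasoning

    -- A closed walk of odd length N winds once around in one direction,
    -- hence visits N distinct residues.
    module Closed (closed : h N ≡ h 0) (N-odd : parity N ≡ 1ℙ) where

      one-direction : fwd N ≡ 0 ⊎ back N ≡ 0
      one-direction = odd-split (count-split forward N) N-odd (sym balanced)
        where
          balanced : back N ≋ fwd N
          balanced = ≋-cancelˡ (h 0) (subst (λ z → z + back N ≋ h 0 + fwd N) closed (winding N))

      forwards-position : back N ≡ 0 → ∀ {k} → k ≤ N → h k ≋ h 0 + k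
      forwards-position back≡0 {k} k≤N = begin
          h k % N             ≡⟨ cong (_% N) (sym (+-identityʳ (h k))) ⟩
          (h k + 0) % N       ≡⟨ cong (λ z → (h k + z) % N) (sym no-back) ⟩
          (h k + back k) % N  ≡⟨ winding k ⟩
          (h 0 + fwd k) % N   ≡⟨ cong (λ z → (h 0 + z) % N) all-fwd ⟩
          (h 0 + k) % N       ∎
        where
          open ≡-Reasoning
          no-back : back k ≡ 0
          no-back = count-vanishes (not ∘ forward) back≡0 k≤N
          all-fwd : fwd k ≡ k
          all-fwd = trans (sym (+-identityʳ (fwd k)))
            (trans (cong (fwd k +_) (sym no-back)) (count-split forward k))

      backwards-position : fwd N ≡ 0 → ∀ {k} → k ≤ N → h k + k ≋ h 0
      backwards-position fwd≡0 {k} k≤N = begin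
          (h k + k) % N       ≡⟨ cong (λ z → (h k + z) % N) (sym all-back) ⟩
          (h k + back k) % N  ≡⟨ winding k ⟩
          (h 0 + fwd k) % N   ≡⟨ cong (λ z → (h 0 + z) % N) no-fwd ⟩
          (h 0 + 0) % N       ≡⟨ cong (_% N) (+-identityʳ (h 0)) ⟩
          h 0 % N             ∎
        where
          open ≡-Reasoning
          no-fwd : fwd k ≡ 0
          no-fwd = count-vanishes forward fwd≡0 k≤N
          all-back : back k ≡ k
          all-back = trans (cong (_+ back k) (sym no-fwd)) (count-split forward k)

      injective : ∀ {i j} → i < N → j < N → h i ≡ h j → i ≡ j
      injective {i} {j} i<N j<N hi≡hj with one-direction
      ... | inj₂ back≡0 = ≋⇒≡ i<N j<N (≋-cancelˡ (h 0)
            (trans (sym (at i<N)) (trans (cong (_% N) hi≡hj) (at j<N))))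
        where
          at : ∀ {k} → k < N → h k ≋ h 0 + k
          at k<N = forwards-position back≡0 (<⇒≤ k<N)
      ... | inj₁ fwd≡0 = ≋⇒≡ i<N j<N (≋-cancelˡ (h i)
            (trans (at i<N) (trans (sym (at j<N)) (cong (λ z → (z + j) % N) (sym hi≡hj)))))
        where
          at : ∀ {k} → k < N → h k + k ≋ h 0
          at k<N = backwards-position fwd≡0 (<⇒≤ k<N)

module OnCycle (m : ℕ) where
  open Modular m

  vertex : ℕ → Fin N
  vertex i = fromℕ< (m%n<n i N)

  toℕ-vertex : ∀ i → toℕ (vertex i) ≡ i % N
  toℕ-vertex i = toℕ-fromℕ< (m%n<n i N)

  vertex-toℕ : ∀ v → vertex (toℕ v) ≡ v
  vertex-toℕ v = toℕ-injective (trans (toℕ-vertex (toℕ v)) (m<n⇒m%n≡m (toℕ<n v)))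

  vertex-closed : vertex N ≡ vertex 0
  vertex-closed = toℕ-injective (trans (toℕ-vertex N) (trans (n%n≡0 N) (sym (toℕ-vertex 0))))

  toℕ-vertex-suc : ∀ i → toℕ (vertex (suc i)) ≡ suc (i % N) % N
  toℕ-vertex-suc i = trans (toℕ-vertex (suc i)) (≋-+ˡ 1 i (i % N) (sym (m%n%n≡m%n i N)))

  vertex-step : ∀ i → CycleStep N (vertex i) (vertex (suc i))
  vertex-step i with m≤n⇒m<n∨m≡n (≤-pred (m%n<n i N))
  ... | inj₁ r<m = inj₁ (trans (toℕ-vertex-suc i)
                          (trans (m<n⇒m%n≡m (s≤s r<m)) (cong suc (sym (toℕ-vertex i)))))
  ... | inj₂ r≡m = inj₂ ( trans (toℕ-vertex i) r≡m
                        , trans (toℕ-vertex-suc i) (trans (cong (λ z → suc z % N) r≡m) (n%n≡0 N)))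

  -- The cycle is connected: a function constant across edges is constant.
  edge-invariant-constant : ∀ {A : Set} (g : Fin N → A) →
    (∀ x y → Adj (Cycle N) x y → g x ≡ g y) → ∀ v w → g v ≡ g w
  edge-invariant-constant g g-edge v w =
    trans (cong g (sym (vertex-toℕ v)))
      (trans (along (toℕ v)) (trans (sym (along (toℕ w))) (cong g (vertex-toℕ w))))
    where
      along : ∀ i → g (vertex i) ≡ g (vertex 0)
      along zero = refl
      along (suc i) = trans (sym (g-edge _ _ (inj₁ (vertex-step i)))) (along i)

  cycleStep⇒step : ∀ {x y} → CycleStep N x y → suc (toℕ x) % N ≡ toℕ y
  cycleStep⇒step {y = y} (inj₁ y≡x+1) = trans (cong (_% N) (sym y≡x+1)) (m<n⇒m%n≡m (toℕ<n y))
  cycleStep⇒step (inj₂ (x≡m , y≡0)) = trans (cong (λ z → suc z % N) x≡m) (trans (n%n≡0 N) (sym y≡0))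

  adjacent⇒step : ∀ {x y} → Adj (Cycle N) x y → Σ Bool λ d → Step d (toℕ x) (toℕ y)
  adjacent⇒step (inj₁ s) = true , cycleStep⇒step s
  adjacent⇒step (inj₂ s) = false , cycleStep⇒step s

  odd-endomorphism-injective : parity N ≡ 1ℙ → ∀ f → End (Cycle N) f →
    ∀ v w → f v ≡ f w → v ≡ w
  odd-endomorphism-injective N-odd f f-end v w fv≡fw =
    toℕ-injective (injective (toℕ<n v) (toℕ<n w) same-image)
    where
      image-step : ∀ i → Σ Bool λ d → Step d (toℕ (f (vertex i))) (toℕ (f (vertex (suc i))))
      image-step i = adjacent⇒step (f-end _ _ (inj₁ (vertex-step i)))
      open Walk (toℕ ∘ f ∘ vertex) (λ i → toℕ<n (f (vertex i)))
                (proj₁ ∘ image-step) (proj₂ ∘ image-step)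
      open Closed (cong (toℕ ∘ f) vertex-closed) N-odd
      same-image : toℕ (f (vertex (toℕ v))) ≡ toℕ (f (vertex (toℕ w)))
      same-image rewrite vertex-toℕ v | vertex-toℕ w = cong toℕ fv≡fw

  hull-odd : parity N ≡ 1ℙ → Hull (Cycle N) ≅ᴳ Complete N
  hull-odd N-odd v w = proj₁ , λ v≢w → v≢w , λ (f , f-end , fv≡fw) →
    v≢w (odd-endomorphism-injective N-odd f f-end v w fv≡fw)

  even-step-flip : parity N ≡ 0ℙ → ∀ {x y} → CycleStep N x y → parity (toℕ y) ≡ parity (toℕ x) ⁻¹
  even-step-flip N-even {x} (inj₁ y≡x+1) = trans (cong parity y≡x+1) (parity-suc (toℕ x))
  even-step-flip N-even (inj₂ (x≡m , y≡0)) =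
    trans (cong parity y≡0) (trans (sym N-even) (trans (parity-suc m) (cong (λ z → parity z ⁻¹) (sym x≡m))))

  even-adjacent-flip : parity N ≡ 0ℙ → ∀ {x y} → Adj (Cycle N) x y → parity (toℕ y) ≡ parity (toℕ x) ⁻¹
  even-adjacent-flip N-even (inj₁ s) = even-step-flip N-even s
  even-adjacent-flip N-even (inj₂ s) = sym (ℙ.⁻¹-selfInverse (sym (even-step-flip N-even s)))

  -- An endomorphism of an even cycle identifies only vertices of equal
  -- parity: parity (f u) ⊕ parity u is invariant across edges.
  even-endomorphism-parity : parity N ≡ 0ℙ → ∀ f → End (Cycle N) f →
    ∀ v w → f v ≡ f w → parity (toℕ v) ≡ parity (toℕ w)
  even-endomorphism-parity N-even f f-end v w fv≡fw =
    ℙ.+-cancelˡ-≡ (parity (toℕ (f v))) (parity (toℕ v)) (parity (toℕ w)) (begin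
      parity (toℕ (f v)) ⊕ parity (toℕ v)  ≡⟨ edge-invariant-constant defect defect-edge v w ⟩
      parity (toℕ (f w)) ⊕ parity (toℕ w)  ≡⟨ cong (λ z → parity (toℕ z) ⊕ parity (toℕ w)) (sym fv≡fw) ⟩
      parity (toℕ (f v)) ⊕ parity (toℕ w)  ∎)
    where
      open ≡-Reasoning
      defect : Fin N → Parity
      defect u = parity (toℕ (f u)) ⊕ parity (toℕ u)
      defect-edge : ∀ x y → Adj (Cycle N) x y → defect x ≡ defect y
      defect-edge x y x~y = begin
        defect x                                     ≡⟨ sym (⁻¹⊕⁻¹ (parity (toℕ (f x))) (parity (toℕ x))) ⟩
        parity (toℕ (f x)) ⁻¹ ⊕ parity (toℕ x) ⁻¹  ≡⟨ sym (cong₂ _⊕_ (flip (f-end x y x~y)) (flip x~y)) ⟩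
        defect y                                     ∎
        where
          flip : ∀ {a b} → Adj (Cycle N) a b → parity (toℕ b) ≡ parity (toℕ a) ⁻¹
          flip = even-adjacent-flip N-even

module Folding (k : ℕ) where
  open OnCycle (suc k)
  open Modular (suc k) using (N)

  -- Even vertices go to 0, odd ones to 1; this is an endomorphism
  -- identifying any two vertices of equal parity.
  colour : Parity → Fin N
  colour 0ℙ = fzero
  colour 1ℙ = fsuc fzero

  colour-adjacent : ∀ p → Adj (Cycle N) (colour p) (colour (p ⁻¹))
  colour-adjacent 0ℙ = inj₁ (inj₁ refl)
  colour-adjacent 1ℙ = inj₂ (inj₁ refl)

  fold : Fin N → Fin N
  fold x = colour (parity (toℕ x))

  fold-endomorphism : parity N ≡ 0ℙ → End (Cycle N) fold
  fold-endomorphism N-even x y x~y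
    rewrite even-adjacent-flip N-even x~y = colour-adjacent (parity (toℕ x))

  hull-even : parity N ≡ 0ℙ → Hull (Cycle N) ≅ᴳ CompleteBipartiteParity N
  hull-even N-even v w = to , from
    where
      to : Adj (Hull (Cycle N)) v w → Adj (CompleteBipartiteParity N) v w
      to (_ , not-identified) same-%2 = not-identified
        (fold , fold-endomorphism N-even , cong colour (same-%2⇒same-parity (toℕ v) (toℕ w) same-%2))
      from : Adj (CompleteBipartiteParity N) v w → Adj (Hull (Cycle N)) v w
      from different-%2 = (λ v≡w → different-%2 (cong (λ u → toℕ u % 2) v≡w))
        , λ (f , f-end , fv≡fw) → different-%2
            (same-parity⇒same-%2 (toℕ v) (toℕ w) (even-endomorphism-parity N-even f f-end v w fv≡fw))

mainTheorem7 : (n : ℕ) → 5 ≤ n →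
    ((n % 2 ≡ 1) → Hull (Cycle n) ≅ᴳ Complete n) ×
    ((n % 2 ≡ 0) → Hull (Cycle n) ≅ᴳ CompleteBipartiteParity n)
mainTheorem7 (suc zero) (s≤s ())
mainTheorem7 (suc (suc k)) _ =
    (λ n%2≡1 → OnCycle.hull-odd (suc k) (%2⇒parity (suc (suc k)) n%2≡1))
  , (λ n%2≡0 → Folding.hull-even k (%2⇒parity (suc (suc k)) n%2≡0))
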